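{- Let $\phi$ and $\psi$ be congruence relations on optiongraphs $\mathsf{C}$ and $\mathsf{D}$, respectively. Then $\theta:=\{((c,d),(c',d'))\mid c\mathrel{\phi}c' \text{ and } d\mathrel{\psi}d'\}$ is a congruence relation on $\mathsf{C}+\mathsf{D}$, and $(\mathsf{C}+\mathsf{D})/\theta$ is isomorphic to $\mathsf{C}/\phi+\mathsf{D}/\psi$.
   Context: An optiongraph is a nonempty set $\mathsf{D}$ (of positions, possibly infinite) together with an option function $\mathrm{Opt}_{\mathsf{D}}:\mathsf{D}\to 2^{\mathsf{D}}$. A function $f:\mathsf{C}\to\mathsf{D}$ is option preserving if $\mathrm{Opt}_{\mathsf{D}}(f(p))=f(\mathrm{Opt}_{\mathsf{C}}(p))$ for all $p$; an isomorphism is a bijective option-preserving map. For an equivalence relation $\theta$, write $[p]$ for the class of $p$ and $[S]:=\{[s]\mid s\in S\}$. An equivalence relation on an optiongraph is a congruence relation if $p\mathrel{\theta}q$ implies $[\mathrm{Opt}(p)]=[\mathrm{Opt}(q)]$. For a congruence relation $\theta$, the quotient optiongraph $\mathsf{D}/\theta$ is the set of classes with option function $\mathrm{Opt}_{\mathsf{D}/\theta}([p]):=[\mathrm{Opt}_{\mathsf{D}}(p)]$. The sum $\mathsf{C}+\mathsf{D}$ of optiongraphs is the set $\mathsf{C}\times\mathsf{D}$ with $\mathrm{Opt}_{\mathsf{C}+\mathsf{D}}(p,q)=(\mathrm{Opt}_{\mathsf{C}}(p)\times\{q\})\cup(\{p\}\times\mathrm{Opt}_{\mathsf{D}}(q))$.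 -}

module Defs where

open import Data.Product using (Σ; ∃; ∃-syntax; _×_; _,_; proj₁; proj₂)
open import Data.Sum using (_⊎_; inj₁; inj₂)
open import Relation.Binary.Core using (Rel)
open import Level using (0ℓ)
open import Relation.Binary.Structures using (IsEquivalence)
open import Relation.Binary.PropositionalEquality
  using (_≡_; refl)

-- Subsets of a type are predicates  A → Set.
-- For a relation R on A, "[S] = [T]" (equality of the sets of R-classes)
-- unfolds to: every s ∈ S is R-related to some t ∈ T and vice versa.

_⊑⟨_⟩_ : {A : Set} → (A → Set) → Rel A 0ℓ → (A → Set) → Set
S ⊑⟨ R ⟩ T = ∀ s → S s → ∃[ t ] (T t × R s t)

ClassEq : {A : Set} → Rel A 0ℓ → (A → Set) → (A → Set) → Set
ClassEq R S T = (S ⊑⟨ R ⟩ T) × (T ⊑⟨ R ⟩ S)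

record OptionGraph : Set₁ where
  field
    Pos      : Set
    point    : Pos                 -- nonemptiness witness
    Opt      : Pos → Pos → Set     -- Opt p q  ⇔  q ∈ Opt(p)

open OptionGraph public

record IsCongruence (D : OptionGraph) (θ : Rel (Pos D) 0ℓ) : Set where
  field
    isEquivalence : IsEquivalence θ
    compatible    : ∀ p q → θ p q → ClassEq θ (Opt D p) (Opt D q)

_⊕_ : OptionGraph → OptionGraph → OptionGraph
C ⊕ D = record
  { Pos   = Pos C × Pos D
  ; point = point C , point D
  ; Opt   = λ { (p , q) (p' , q') →
                  (Opt C p p' × q' ≡ q) ⊎ (p' ≡ p × Opt D q q') } }

-- Since Agda (without cubical) has no quotient types, a quotient
-- optiongraph is represented as a "setoid optiongraph": an optiongraph
-- on the set of ≈-classes of Pos.  Opt p is a subset of Pos that is read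
-- up to ≈, i.e. the class-level option set is [Opt p]; opt-cong says this
-- is well defined on classes.

record SetoidOptionGraph : Set₁ where
  field
    Pos      : Set
    _≈_      : Rel Pos 0ℓ
    isEquiv  : IsEquivalence _≈_
    point    : Pos
    Opt      : Pos → Pos → Set
    opt-cong : ∀ p q → p ≈ q → ClassEq _≈_ (Opt p) (Opt q)

module SOG = SetoidOptionGraph

-- The quotient optiongraph D/θ (positions are θ-classes, represented by
-- their elements; Opt_{D/θ}([p]) = [Opt_D(p)]).
Quotient : (D : OptionGraph) (θ : Rel (Pos D) 0ℓ) → IsCongruence D θ →
           SetoidOptionGraph
Quotient D θ c = record
  { Pos      = Pos D
  ; _≈_      = θ
  ; isEquiv  = IsCongruence.isEquivalence c
  ; point    = point D
  ; Opt      = Opt D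
  ; opt-cong = IsCongruence.compatible c }

-- Sum of (setoid) optiongraphs: positions of C/φ + D/ψ are pairs of
-- classes, i.e. pairs up to the componentwise relation.
_⊕ˢ_ : SetoidOptionGraph → SetoidOptionGraph → SetoidOptionGraph
C ⊕ˢ D = record
  { Pos      = SOG.Pos C × SOG.Pos D
  ; _≈_      = λ { (p , q) (p' , q') → SOG._≈_ C p p' × SOG._≈_ D q q' }
  ; isEquiv  = record
      { refl  = λ { {p , q} → IsEquivalence.refl (SOG.isEquiv C)
                             , IsEquivalence.refl (SOG.isEquiv D) }
      ; sym   = λ { (a , b) → IsEquivalence.sym (SOG.isEquiv C) a
                             , IsEquivalence.sym (SOG.isEquiv D) b }
      ; trans = λ { (a , b) (a' , b') → IsEquivalence.trans (SOG.isEquiv C) a a'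
                                        , IsEquivalence.trans (SOG.isEquiv D) b b' } }
  ; point    = SOG.point C , SOG.point D
  ; Opt      = OptS
  ; opt-cong = cong }
  where
  OptS : SOG.Pos C × SOG.Pos D → SOG.Pos C × SOG.Pos D → Set
  OptS (p , q) (p' , q') = (SOG.Opt C p p' × q' ≡ q) ⊎ (p' ≡ p × SOG.Opt D q q')

  half : ∀ x y → (SOG._≈_ C (proj₁ x) (proj₁ y) × SOG._≈_ D (proj₂ x) (proj₂ y)) →
         OptS x ⊑⟨ (λ { (p , q) (p' , q') → SOG._≈_ C p p' × SOG._≈_ D q q' }) ⟩ OptS y
  half (p , q) (r , s) (pr , qs) (p' , .q) (inj₁ (o , refl))
    with proj₁ (SOG.opt-cong C p r pr) p' o
  ... | r' , o' , e = (r' , s) , inj₁ (o' , refl) , e , qs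
  half (p , q) (r , s) (pr , qs) (.p , q') (inj₂ (refl , o))
    with proj₁ (SOG.opt-cong D q s qs) q' o
  ... | s' , o' , e = (r , s') , inj₂ (refl , o') , pr , e

  cong : ∀ x y → _ → _
  cong x y (a , b) = half x y (a , b)
                   , half y x (IsEquivalence.sym (SOG.isEquiv C) a
                              , IsEquivalence.sym (SOG.isEquiv D) b)

record IsOptionPreserving (A B : SetoidOptionGraph)
       (f : SOG.Pos A → SOG.Pos B) : Set where
  field
    well-defined : ∀ x y → SOG._≈_ A x y → SOG._≈_ B (f x) (f y)
    -- Opt_B(f p) = f(Opt_A p)  as sets of classes
    preserves    : ∀ p →
      (∀ y → SOG.Opt B (f p) y → ∃[ x ] (SOG.Opt A p x × SOG._≈_ B y (f x))) ×
      (∀ x → SOG.Opt A p x → ∃[ y ] (SOG.Opt B (f p) y × SOG._≈_ B (f x) y))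

record IsIsomorphism (A B : SetoidOptionGraph)
       (f : SOG.Pos A → SOG.Pos B) : Set where
  field
    optionPreserving : IsOptionPreserving A B f
    injective  : ∀ x y → SOG._≈_ B (f x) (f y) → SOG._≈_ A x y
    surjective : ∀ y → ∃[ x ] SOG._≈_ B (f x) y

_≅_ : SetoidOptionGraph → SetoidOptionGraph → Set
A ≅ B = Σ (SOG.Pos A → SOG.Pos B) (IsIsomorphism A B)

ProdRel : (C D : OptionGraph) → Rel (Pos C) 0ℓ → Rel (Pos D) 0ℓ →
          Rel (Pos (C ⊕ D)) 0ℓ
ProdRel C D φ ψ (c , d) (c' , d') = φ c c' × ψ d d'

{-# OPTIONS --safe #-}
module Submission where

open import Defs
open import Data.Product using (Σ; _,_; proj₁)
open import Data.Product.Relation.Binary.Pointwise.NonDependent using (×-isEquivalence)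
open import Data.Sum using (inj₁; inj₂)
open import Function using (id)
open import Relation.Binary.Core using (Rel)
open import Relation.Binary.Structures using (IsEquivalence)
open import Relation.Binary.PropositionalEquality using (refl)
open import Level using (0ℓ)

open IsCongruence using (isEquivalence; compatible)

Simulation : (D : OptionGraph) → Rel (Pos D) 0ℓ → Set
Simulation D θ = ∀ p q → θ p q → Opt D p ⊑⟨ θ ⟩ Opt D q

congruence⇒simulation : ∀ {D θ} → IsCongruence D θ → Simulation D θ
congruence⇒simulation c p q pθq = proj₁ (compatible c p q pθq)

simulation⇒congruence : ∀ {D θ} → IsEquivalence θ → Simulation D θ → IsCongruence D θ
simulation⇒congruence eq sim = record
  { isEquivalence = eq
  ; compatible    = λ p q pθq → sim p q pθq , sim q p (IsEquivalence.sym eq pθq) }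

⊕-simulation : (C D : OptionGraph) {φ : Rel (Pos C) 0ℓ} {ψ : Rel (Pos D) 0ℓ} →
               Simulation C φ → Simulation D ψ →
               Simulation (C ⊕ D) (ProdRel C D φ ψ)
⊕-simulation C D simφ simψ (p , q) (r , s) (pφr , qψs) (p' , .q) (inj₁ (p→p' , refl))
  with simφ p r pφr p' p→p'
... | r' , r→r' , p'φr' = (r' , s) , inj₁ (r→r' , refl) , p'φr' , qψs
⊕-simulation C D simφ simψ (p , q) (r , s) (pφr , qψs) (.p , q') (inj₂ (refl , q→q'))
  with simψ q s qψs q' q→q'
... | s' , s→s' , q'ψs' = (r , s') , inj₂ (refl , s→s') , pφr , q'ψs'

⊕-congruence : (C D : OptionGraph) {φ : Rel (Pos C) 0ℓ} {ψ : Rel (Pos D) 0ℓ} →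
               IsCongruence C φ → IsCongruence D ψ →
               IsCongruence (C ⊕ D) (ProdRel C D φ ψ)
⊕-congruence C D cφ cψ = simulation⇒congruence
  (×-isEquivalence (isEquivalence cφ) (isEquivalence cψ))
  (⊕-simulation C D (congruence⇒simulation cφ) (congruence⇒simulation cψ))

-- Quotients are represented by representatives, so [(c , d)] ↦ ([c] , [d]) is
-- the identity: both sides share positions, equivalence and options.
quotient-⊕-isIsomorphism :
  (C D : OptionGraph) {φ : Rel (Pos C) 0ℓ} {ψ : Rel (Pos D) 0ℓ}
  (cφ : IsCongruence C φ) (cψ : IsCongruence D ψ) (cθ : IsCongruence (C ⊕ D) (ProdRel C D φ ψ)) →
  IsIsomorphism (Quotient (C ⊕ D) (ProdRel C D φ ψ) cθ) (Quotient C φ cφ ⊕ˢ Quotient D ψ cψ) id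
quotient-⊕-isIsomorphism C D cφ cψ cθ = record
  { optionPreserving = record
    { well-defined = λ _ _ xθy → xθy
    ; preserves    = λ _ → (λ y p→y → y , p→y , θ-refl) , (λ x p→x → x , p→x , θ-refl) }
  ; injective      = λ _ _ xθy → xθy
  ; surjective     = λ y → y , θ-refl }
  where θ-refl = IsEquivalence.refl (isEquivalence cθ)

mainTheorem18 : (C D : OptionGraph) (φ : Rel (Pos C) 0ℓ) (ψ : Rel (Pos D) 0ℓ) →
    (cφ : IsCongruence C φ) (cψ : IsCongruence D ψ) →
    Σ (IsCongruence (C ⊕ D) (ProdRel C D φ ψ)) λ cθ →
      Quotient (C ⊕ D) (ProdRel C D φ ψ) cθ ≅ (Quotient C φ cφ ⊕ˢ Quotient D ψ cψ)
mainTheorem18 C D φ ψ cφ cψ =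
  cθ , id , quotient-⊕-isIsomorphism C D cφ cψ cθ
  where cθ = ⊕-congruence C D cφ cψ
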